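{- Let $n>3$ and $\varphi\in\mathcal S_{I_n}$. If $\overline\varphi\circ\zeta_n\circ\overline\varphi^{ -1}=\zeta_n$, then $\varphi=\mathrm{id}_{I_n}$.
   Context: $I_n=\{1,\dots,n\}$, $\mathcal S_X$ the permutations of $X$, $\wp_2(X)$ the 2-subsets. $\zeta_n$ is the permutation of $\wp_2(I_n)$ with $\zeta_n(\{i,j\})=\{j-i,j\}$ for $1\le i<j\le n$, and $\overline\varphi(\{i,j\})=\{\varphi(i),\varphi(j)\}$. -}

module Defs where

open import Data.Nat as ℕ using (ℕ; zero; suc; _∸_; z≤n; s≤s)
open import Data.Nat.Properties as ℕP using (m∸n≤m; ≤-trans; <-≤-trans)
open import Data.Fin using (Fin; toℕ; fromℕ<; _<_)
open import Data.Fin.Properties using (<-cmp; toℕ<n; toℕ-fromℕ<; <-irrefl)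
open import Data.Fin.Permutation using (Permutation′; _⟨$⟩ʳ_; _⟨$⟩ˡ_; inverseˡ)
open import Data.Product using (_×_)
open import Relation.Binary.Definitions using (tri<; tri≈; tri>)
open import Relation.Binary.PropositionalEquality using (_≡_; refl; sym; trans; cong; subst)
open import Data.Empty using (⊥-elim)

-- Convention: I_n = {1,…,n} is represented by Fin n, element k : Fin n
-- standing for the integer toℕ k + 1.

record P₂ (n : ℕ) : Set where
  constructor ⟪_,_,_⟫
  field
    lo  : Fin n
    hi  : Fin n
    lo<hi : lo < hi
open P₂ public

_≈₂_ : ∀ {n} → P₂ n → P₂ n → Set
p ≈₂ q = (lo p ≡ lo q) × (hi p ≡ hi q)

private
  lemma : ∀ a b → a ℕ.< b → (b ∸ a) ∸ 1 ℕ.< b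
  lemma zero (suc b) _ = s≤s ℕP.≤-refl
  lemma (suc a) (suc b) (s≤s a<b) = ℕP.<-trans (lemma a b a<b) (ℕP.n<1+n b)

-- ζ_n({i,j}) = {j-i, j} for i<j.  In 0-based indices a = i-1, b = j-1
-- the element j-i has 0-based index (b ∸ a) ∸ 1.
ζ : ∀ {n} → P₂ n → P₂ n
ζ {n} ⟪ a , b , a<b ⟫ =
  ⟪ fromℕ< {(toℕ b ∸ toℕ a) ∸ 1} (ℕP.<-trans (lemma (toℕ a) (toℕ b) a<b) (toℕ<n b))
  , b
  , subst (ℕ._< toℕ b) (sym (toℕ-fromℕ< _)) (lemma (toℕ a) (toℕ b) a<b) ⟫

image₂ : ∀ {n} (f : Fin n → Fin n) → (∀ {x y} → f x ≡ f y → x ≡ y) → P₂ n → P₂ n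
image₂ f inj ⟪ a , b , a<b ⟫ with <-cmp (f a) (f b)
... | tri< fa<fb _ _ = ⟪ f a , f b , fa<fb ⟫
... | tri≈ _ fa≡fb _ = ⊥-elim (<-irrefl (inj fa≡fb) a<b)
... | tri> _ _ fb<fa = ⟪ f b , f a , fb<fa ⟫

bar : ∀ {n} → Permutation′ n → P₂ n → P₂ n
bar φ = image₂ (φ ⟨$⟩ʳ_) inj
  where
  inj : ∀ {x y} → φ ⟨$⟩ʳ x ≡ φ ⟨$⟩ʳ y → x ≡ y
  inj {x} {y} e = trans (sym (inverseˡ φ)) (trans (cong (φ ⟨$⟩ˡ_) e) (inverseˡ φ))

-- (φ̄)⁻¹ = (φ⁻¹)‾ : {i,j} ↦ {φ⁻¹(i), φ⁻¹(j)}
bar⁻¹ : ∀ {n} → Permutation′ n → P₂ n → P₂ n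
bar⁻¹ φ = image₂ (φ ⟨$⟩ˡ_) inj
  where
  open import Data.Fin.Permutation using (inverseʳ)
  inj : ∀ {x y} → φ ⟨$⟩ˡ x ≡ φ ⟨$⟩ˡ y → x ≡ y
  inj {x} {y} e = trans (sym (inverseʳ φ)) (trans (cong (φ ⟨$⟩ʳ_) e) (inverseʳ φ))

-- Write ψ = φ⁻¹ and compare both sides of the hypothesis at {i, j}, i < j.  If ψ i < ψ j the
-- pairs {φ (ψ j − ψ i), j} and {j − i, j} coincide, so ψ (j − i) = ψ j − ψ i; if ψ j < ψ i they
-- force i = j − i and ψ j = ψ i − ψ j.  Hence ψ 1 = 1: otherwise k = φ 1 has ψ k = 1 < ψ 1,
-- so k = 2 and ψ 1 = 2, and then ψ 2 = ψ 4 − ψ 2 with ψ 2 = 1 gives ψ 4 = 2 = ψ 1 (here n > 3 is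
-- needed).  Finally ψ (j − 1) = ψ j − 1 for every j > 1, and induction on j shows ψ = id.
-- Indices below are 0-based, so 1 and 4 are the elements z and three with toℕ 0 and 3.
module Submission where

open import Defs
open import Data.Nat using (ℕ; _<_)
open import Data.Fin using (Fin)
open import Data.Fin.Permutation using (Permutation′; _⟨$⟩ʳ_)
open import Relation.Binary.PropositionalEquality using (_≡_)

open import Data.Nat as ℕ using (suc; _∸_; z≤n; s≤s)
open import Data.Fin as Fin using (toℕ)
open import Data.Fin.Properties as Finₚ using (<-cmp; toℕ-injective; toℕ-fromℕ<; ≤∧≢⇒<)
open import Data.Fin.Permutation using (_⟨$⟩ˡ_; inverseˡ; inverseʳ)
open import Data.Product using (_×_; _,_; proj₁; proj₂)
open import Data.Sum using (_⊎_; inj₁; inj₂)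
open import Data.Empty using (⊥-elim)
open import Relation.Binary.Definitions using (tri<; tri≈; tri>)
open import Relation.Binary.PropositionalEquality
  using (_≢_; refl; sym; trans; cong; cong₂; subst; subst₂; ≢-sym; module ≡-Reasoning)
open import Relation.Nullary using (yes; no)
open import Function using (_∘_)

m≡n∸o∸1⇒n≡1+m : ∀ {m n o} → o ≡ 0 → o ℕ.< n → m ≡ n ∸ o ∸ 1 → n ≡ suc m
m≡n∸o∸1⇒n≡1+m refl (s≤s _) refl = refl

image₂-elements : ∀ {n} (f : Fin n → Fin n) (inj : ∀ {x y} → f x ≡ f y → x ≡ y) (p : P₂ n) →
  (lo (image₂ f inj p) ≡ f (lo p) × hi (image₂ f inj p) ≡ f (hi p)) ⊎
  (lo (image₂ f inj p) ≡ f (hi p) × hi (image₂ f inj p) ≡ f (lo p))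
image₂-elements f inj ⟪ a , b , a<b ⟫ with <-cmp (f a) (f b)
... | tri< _ _ _     = inj₁ (refl , refl)
... | tri≈ _ fa≡fb _ = ⊥-elim (Finₚ.<-irrefl (inj fa≡fb) a<b)
... | tri> _ _ _     = inj₂ (refl , refl)

image₂-monotone : ∀ {n} (f : Fin n → Fin n) (inj : ∀ {x y} → f x ≡ f y → x ≡ y) (p : P₂ n) →
  f (lo p) Fin.< f (hi p) → lo (image₂ f inj p) ≡ f (lo p) × hi (image₂ f inj p) ≡ f (hi p)
image₂-monotone f inj p fl<fh with image₂-elements f inj p
... | inj₁ elements        = elements
... | inj₂ (lo≡fh , hi≡fl) =
  ⊥-elim (Finₚ.<-asym fl<fh (subst₂ Fin._<_ lo≡fh hi≡fl (lo<hi (image₂ f inj p))))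

image₂-antitone : ∀ {n} (f : Fin n → Fin n) (inj : ∀ {x y} → f x ≡ f y → x ≡ y) (p : P₂ n) →
  f (hi p) Fin.< f (lo p) → lo (image₂ f inj p) ≡ f (hi p) × hi (image₂ f inj p) ≡ f (lo p)
image₂-antitone f inj p fh<fl with image₂-elements f inj p
... | inj₂ elements        = elements
... | inj₁ (lo≡fl , hi≡fh) =
  ⊥-elim (Finₚ.<-asym fh<fl (subst₂ Fin._<_ lo≡fl hi≡fh (lo<hi (image₂ f inj p))))

toℕ≡0∧≢⇒< : ∀ {n} {x y : Fin n} → toℕ x ≡ 0 → y ≢ x → x Fin.< y
toℕ≡0∧≢⇒< {y = y} x≡0 y≢x = ≤∧≢⇒< (subst (ℕ._≤ toℕ y) (sym x≡0) z≤n) (≢-sym y≢x)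

toℕ-lo-ζ : ∀ {n} (p : P₂ n) → toℕ (lo (ζ p)) ≡ toℕ (hi p) ∸ toℕ (lo p) ∸ 1
toℕ-lo-ζ p = toℕ-fromℕ< _

module ζ-Commuting {n : ℕ} (φ : Permutation′ n)
                   (commutes : ∀ p → bar φ (ζ (bar⁻¹ φ p)) ≈₂ ζ p) where

  ψ : Fin n → Fin n
  ψ x = φ ⟨$⟩ˡ x

  ψ-injective : ∀ {x y} → ψ x ≡ ψ y → x ≡ y
  ψ-injective {x} {y} ψx≡ψy = trans (sym (inverseʳ φ)) (trans (cong (φ ⟨$⟩ʳ_) ψx≡ψy) (inverseʳ φ))

  ζ-ascending : ∀ {a b} (a<b : a Fin.< b) → ψ a Fin.< ψ b →
                ∀ d → toℕ d ≡ toℕ b ∸ toℕ a ∸ 1 → toℕ (ψ d) ≡ toℕ (ψ b) ∸ toℕ (ψ a) ∸ 1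
  ζ-ascending {a} {b} a<b ψa<ψb d d≡b∸a∸1 = begin
    toℕ (ψ d)                     ≡⟨ cong (toℕ ∘ ψ) d≡loζp ⟩
    toℕ (ψ (lo (ζ p)))            ≡⟨ cong (toℕ ∘ ψ) (sym φ-loζq≡loζp) ⟩
    toℕ (ψ (φ ⟨$⟩ʳ lo (ζ q)))     ≡⟨ cong toℕ (inverseˡ φ) ⟩
    toℕ (lo (ζ q))                ≡⟨ toℕ-lo-ζ q ⟩
    toℕ (hi q) ∸ toℕ (lo q) ∸ 1   ≡⟨ cong₂ (λ h l → toℕ h ∸ toℕ l ∸ 1) hq≡ψb lq≡ψa ⟩
    toℕ (ψ b) ∸ toℕ (ψ a) ∸ 1     ∎
    where
    open ≡-Reasoning
    p q : P₂ n
    p = ⟪ a , b , a<b ⟫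
    q = bar⁻¹ φ p
    lq≡ψa : lo q ≡ ψ a
    lq≡ψa = proj₁ (image₂-monotone ψ _ p ψa<ψb)
    hq≡ψb : hi q ≡ ψ b
    hq≡ψb = proj₂ (image₂-monotone ψ _ p ψa<ψb)
    d≡loζp : d ≡ lo (ζ p)
    d≡loζp = toℕ-injective (trans d≡b∸a∸1 (sym (toℕ-lo-ζ p)))
    φ-loζq≡loζp : φ ⟨$⟩ʳ lo (ζ q) ≡ lo (ζ p)
    φ-loζq≡loζp with image₂-elements (φ ⟨$⟩ʳ_) _ (ζ q)
    ... | inj₁ (lo≡ , _)   = trans (sym lo≡) (proj₁ (commutes p))
    ... | inj₂ (lo≡ , _)   = ⊥-elim (Finₚ.<-irrefl lo≡hi (lo<hi (bar φ (ζ q))))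
      where
      lo≡hi : lo (bar φ (ζ q)) ≡ hi (bar φ (ζ q))
      lo≡hi = trans lo≡ (trans (cong (φ ⟨$⟩ʳ_) hq≡ψb) (trans (inverseʳ φ) (sym (proj₂ (commutes p)))))

  ζ-descending : ∀ {a b} (a<b : a Fin.< b) → ψ b Fin.< ψ a →
                 toℕ a ≡ toℕ b ∸ toℕ a ∸ 1 × toℕ (ψ b) ≡ toℕ (ψ a) ∸ toℕ (ψ b) ∸ 1
  ζ-descending {a} {b} a<b ψb<ψa = equations
    where
    open ≡-Reasoning
    p q : P₂ n
    p = ⟪ a , b , a<b ⟫
    q = bar⁻¹ φ p
    lq≡ψb : lo q ≡ ψ b
    lq≡ψb = proj₁ (image₂-antitone ψ _ p ψb<ψa)
    hq≡ψa : hi q ≡ ψ a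
    hq≡ψa = proj₂ (image₂-antitone ψ _ p ψb<ψa)
    φ-hq≡a : φ ⟨$⟩ʳ hi q ≡ a
    φ-hq≡a = trans (cong (φ ⟨$⟩ʳ_) hq≡ψa) (inverseʳ φ)
    equations : toℕ a ≡ toℕ b ∸ toℕ a ∸ 1 × toℕ (ψ b) ≡ toℕ (ψ a) ∸ toℕ (ψ b) ∸ 1
    equations with image₂-elements (φ ⟨$⟩ʳ_) _ (ζ q)
    ... | inj₁ (_ , hi≡) =
      ⊥-elim (Finₚ.<-irrefl (trans (sym φ-hq≡a) (trans (sym hi≡) (proj₂ (commutes p)))) a<b)
    ... | inj₂ (lo≡ , hi≡) =
      trans (cong toℕ (trans (sym φ-hq≡a) (trans (sym lo≡) (proj₁ (commutes p))))) (toℕ-lo-ζ p) ,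
      (begin
        toℕ (ψ b)                     ≡⟨ cong (toℕ ∘ ψ) (trans (sym (proj₂ (commutes p))) hi≡) ⟩
        toℕ (ψ (φ ⟨$⟩ʳ lo (ζ q)))     ≡⟨ cong toℕ (inverseˡ φ) ⟩
        toℕ (lo (ζ q))                ≡⟨ toℕ-lo-ζ q ⟩
        toℕ (hi q) ∸ toℕ (lo q) ∸ 1   ≡⟨ cong₂ (λ h l → toℕ h ∸ toℕ l ∸ 1) hq≡ψa lq≡ψb ⟩
        toℕ (ψ a) ∸ toℕ (ψ b) ∸ 1     ∎)

  ψ⁻¹-zero≡zero : ∀ z three → toℕ z ≡ 0 → toℕ three ≡ 3 → ∀ k → toℕ (ψ k) ≡ 0 → k ≡ z
  ψ⁻¹-zero≡zero z three z≡0 three≡3 k ψk≡0 with k Finₚ.≟ z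
  ... | yes k≡z = k≡z
  ... | no k≢z  = ⊥-elim (three≢z (ψ-injective (toℕ-injective (trans ψthree≡1+ψk (sym ψz≡1+ψk)))))
    where
    three≢z : three ≢ z
    three≢z three≡z with trans (sym three≡3) (trans (cong toℕ three≡z) z≡0)
    ... | ()
    z<k : z Fin.< k
    z<k = toℕ≡0∧≢⇒< z≡0 k≢z
    ψk<ψz : ψ k Fin.< ψ z
    ψk<ψz = toℕ≡0∧≢⇒< ψk≡0 (≢-sym k≢z ∘ ψ-injective)
    k≡1 : toℕ k ≡ 1
    k≡1 = trans (m≡n∸o∸1⇒n≡1+m z≡0 z<k (proj₁ (ζ-descending z<k ψk<ψz))) (cong suc z≡0)
    ψz≡1+ψk : toℕ (ψ z) ≡ suc (toℕ (ψ k))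
    ψz≡1+ψk = m≡n∸o∸1⇒n≡1+m ψk≡0 ψk<ψz (proj₂ (ζ-descending z<k ψk<ψz))
    three≢k : three ≢ k
    three≢k three≡k with trans (sym three≡3) (trans (cong toℕ three≡k) k≡1)
    ... | ()
    k<three : k Fin.< three
    k<three = subst₂ ℕ._<_ (sym k≡1) (sym three≡3) (s≤s (s≤s z≤n))
    ψk<ψthree : ψ k Fin.< ψ three
    ψk<ψthree = toℕ≡0∧≢⇒< ψk≡0 (three≢k ∘ ψ-injective)
    k≡three∸k∸1 : toℕ k ≡ toℕ three ∸ toℕ k ∸ 1
    k≡three∸k∸1 = trans k≡1 (cong₂ (λ t u → t ∸ u ∸ 1) (sym three≡3) (sym k≡1))
    ψthree≡1+ψk : toℕ (ψ three) ≡ suc (toℕ (ψ k))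
    ψthree≡1+ψk = m≡n∸o∸1⇒n≡1+m ψk≡0 ψk<ψthree (ζ-ascending k<three ψk<ψthree k k≡three∸k∸1)

  ψ-fixes-zero : ∀ z three → toℕ z ≡ 0 → toℕ three ≡ 3 → toℕ (ψ z) ≡ 0
  ψ-fixes-zero z three z≡0 three≡3 = begin
    toℕ (ψ z)                ≡⟨ cong (toℕ ∘ ψ) (sym (ψ⁻¹-zero≡zero z three z≡0 three≡3 (φ ⟨$⟩ʳ z) ψφz≡0)) ⟩
    toℕ (ψ (φ ⟨$⟩ʳ z))       ≡⟨ ψφz≡0 ⟩
    0                        ∎
    where
    open ≡-Reasoning
    ψφz≡0 : toℕ (ψ (φ ⟨$⟩ʳ z)) ≡ 0
    ψφz≡0 = trans (cong toℕ (inverseˡ φ)) z≡0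

  ψ-fixes-all : ∀ z → toℕ z ≡ 0 → toℕ (ψ z) ≡ 0 → ∀ b → ψ b ≡ b
  ψ-fixes-all z z≡0 ψz≡0 b = toℕ-injective (ψ-fixes-toℕ (toℕ b) b refl)
    where
    ψ-fixes-toℕ : ∀ j b → toℕ b ≡ j → toℕ (ψ b) ≡ j
    ψ-fixes-toℕ ℕ.zero b b≡0 = trans (cong (toℕ ∘ ψ) (toℕ-injective (trans b≡0 (sym z≡0)))) ψz≡0
    ψ-fixes-toℕ (suc j) b b≡1+j =
      m≡n∸o∸1⇒n≡1+m ψz≡0 ψz<ψb (trans (sym ψd≡j) (ζ-ascending z<b ψz<ψb d (toℕ-lo-ζ ⟪ z , b , z<b ⟫)))
      where
      b≢z : b ≢ z
      b≢z b≡z with trans (sym b≡1+j) (trans (cong toℕ b≡z) z≡0)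
      ... | ()
      z<b : z Fin.< b
      z<b = toℕ≡0∧≢⇒< z≡0 b≢z
      ψz<ψb : ψ z Fin.< ψ b
      ψz<ψb = toℕ≡0∧≢⇒< ψz≡0 (b≢z ∘ ψ-injective)
      d : Fin n
      d = lo (ζ ⟪ z , b , z<b ⟫)
      ψd≡j : toℕ (ψ d) ≡ j
      ψd≡j = ψ-fixes-toℕ j d (trans (toℕ-lo-ζ ⟪ z , b , z<b ⟫) (cong₂ (λ x y → x ∸ y ∸ 1) b≡1+j z≡0))

lemma2p13 : (n : ℕ) → 3 < n → (φ : Permutation′ n) →
    (∀ (p : P₂ n) → bar φ (ζ (bar⁻¹ φ p)) ≈₂ ζ p) →
    ∀ (i : Fin n) → φ ⟨$⟩ʳ i ≡ i
lemma2p13 _ (s≤s (s≤s (s≤s (s≤s _)))) φ commutes i = begin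
  φ ⟨$⟩ʳ i            ≡⟨ cong (φ ⟨$⟩ʳ_) (sym (ψ-fixes-all Fin.zero refl ψ-zero≡0 i)) ⟩
  φ ⟨$⟩ʳ (φ ⟨$⟩ˡ i)   ≡⟨ inverseʳ φ ⟩
  i                   ∎
  where
  open ≡-Reasoning
  open ζ-Commuting φ commutes
  ψ-zero≡0 : toℕ (ψ Fin.zero) ≡ 0
  ψ-zero≡0 = ψ-fixes-zero Fin.zero (Fin.suc (Fin.suc (Fin.suc Fin.zero))) refl refl
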